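{- If for each $i\in N$ the set $\mathcal{V}_i\subseteq\mathrm{Obj}(\mathbb{E}_{X_i})$ is an invariant for the Duplicator in the codensity game $\mathcal{G}_{c_i}$, then $\prod_{i\in N}\mathcal{V}_i$ is an invariant for the Duplicator in the composite codensity game $\mathcal{G}$.
   Context: $(p\colon\mathbb{E}\to\mathbb{B},O,\Omega)$ is a $\mathbf{CLat}_\sqcap$-fibration with truth values indexed by discrete $A$ (fibers complete lattices with order $\sqsubseteq$ and meet $\bigwedge$, meet-preserving reindexing, $O=p\circ\Omega$); $F\colon\mathbb{B}\to\mathbb{B}$, $\tau\colon F\circ O\Rightarrow O$; $T\colon\mathbb{B}^N\to\mathbb{B}$, $\sigma\colon T\circ\langle O,\dots,O\rangle\Rightarrow O$; $c_i\colon X_i\to FX_i$ are $F$-coalgebras. $T^{\Omega}_{\sigma}(P_1,\dots,P_N)=\bigwedge_{a\in A,\,k_i\in\mathbb{E}(P_i,\Omega(a))}(\sigma_a\circ T(pk_1,\dots,pk_N))^*\Omega(a)$. The codensity game $\mathcal{G}_c$ for $c\colon X\to FX$ has Duplicator positions $(a,k)$ with $k\in\mathbb{B}(X,O(a))$, Spoiler positions $P\in\mathrm{Obj}(\mathbb{E}_X)$, moves $P\to(a,k)$ if $P\not\sqsubseteq(\tau_a\circ Fk\circ c)^*\Omega(a)$ and $(a,k)\to P'$ if $P'\not\sqsubseteq k^*\Omega(a)$. The composite codensity game $\mathcal{G}$ has Duplicator positions $(a,(k_i)_i)$ with $k_i\in\mathbb{B}(X_i,O(a))$, Spoiler positions $(P_i)_i\in\prod_i\mathrm{Obj}(\mathbb{E}_{X_i})$,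 moves $(P_i)_i\to(a,(k_i)_i)$ if $T^{\Omega}_{\sigma}(P_1,\dots,P_N)\not\sqsubseteq(\sigma_a\circ T(\tau_a\circ Fk_1\circ c_1,\dots,\tau_a\circ Fk_N\circ c_N))^*\Omega(a)$ and $(a,(k_i)_i)\to(P'_i)_i$ if some $i$ has $P'_i\not\sqsubseteq k_i^*\Omega(a)$. An invariant for Duplicator is a set $\mathcal{V}$ of Spoiler positions such that for $q\in\mathcal{V}$ and any move $q\to q'$ there is $q''\in\mathcal{V}$ with $q'\to q''$. -}

module Defs where

open import Level using (Level; _⊔_) renaming (suc to lsuc)
open import Data.Nat using (ℕ)
open import Data.Fin using (Fin)
open import Data.Product using (Σ; _×_; _,_; proj₁; proj₂)
open import Relation.Binary.PropositionalEquality using (_≡_)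
open import Relation.Nullary using (¬_)

record Category (ℓ : Level) : Set (lsuc ℓ) where
  infixr 9 _∘_
  field
    Ob  : Set ℓ
    Hom : Ob → Ob → Set ℓ
    id  : ∀ {X} → Hom X X
    _∘_ : ∀ {X Y Z} → Hom Y Z → Hom X Y → Hom X Z
    identityˡ : ∀ {X Y} (f : Hom X Y) → id ∘ f ≡ f
    identityʳ : ∀ {X Y} (f : Hom X Y) → f ∘ id ≡ f
    assoc : ∀ {W X Y Z} (h : Hom Y Z) (g : Hom X Y) (f : Hom W X) →
            (h ∘ g) ∘ f ≡ h ∘ (g ∘ f)

record Endofunctor {ℓ : Level} (B : Category ℓ) : Set ℓ where
  open Category B
  field
    F₀ : Ob → Ob
    F₁ : ∀ {X Y} → Hom X Y → Hom (F₀ X) (F₀ Y)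
    F-id : ∀ {X} → F₁ (id {X}) ≡ id
    F-∘ : ∀ {X Y Z} (g : Hom Y Z) (f : Hom X Y) → F₁ (g ∘ f) ≡ F₁ g ∘ F₁ f

record NaryFunctor {ℓ : Level} (N : ℕ) (B : Category ℓ) : Set ℓ where
  open Category B
  field
    T₀ : (Fin N → Ob) → Ob
    T₁ : ∀ {X Y : Fin N → Ob} → ((i : Fin N) → Hom (X i) (Y i)) → Hom (T₀ X) (T₀ Y)
    T-id : ∀ {X : Fin N → Ob} → T₁ (λ i → id {X i}) ≡ id
    T-∘ : ∀ {X Y Z : Fin N → Ob}
            (g : (i : Fin N) → Hom (Y i) (Z i)) (f : (i : Fin N) → Hom (X i) (Y i)) →
            T₁ (λ i → g i ∘ f i) ≡ T₁ g ∘ T₁ f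

-- CLat_⊓-fibrations p : E → B, presented (via the Grothendieck
-- correspondence) as an indexed family of complete lattices with
-- meet-preserving reindexing.  E_X = Fib X; a morphism P → Q of E
-- over f : X → Y is exactly a proof of P ⊑ f^* Q, and p sends it to f.

record CLatFibration {ℓ : Level} (B : Category ℓ) : Set (lsuc ℓ) where
  open Category B
  infix 4 _⊑_
  infixr 8 _^*_
  field
    Fib : Ob → Set ℓ
    _⊑_ : ∀ {X} → Fib X → Fib X → Set ℓ
    ⊑-refl : ∀ {X} {P : Fib X} → P ⊑ P
    ⊑-trans : ∀ {X} {P Q R : Fib X} → P ⊑ Q → Q ⊑ R → P ⊑ R
    ⊑-antisym : ∀ {X} {P Q : Fib X} → P ⊑ Q → Q ⊑ P → P ≡ Q
    ⋀ : ∀ {X} {I : Set ℓ} → (I → Fib X) → Fib X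
    ⋀-lb : ∀ {X} {I : Set ℓ} (P : I → Fib X) (i : I) → ⋀ P ⊑ P i
    ⋀-glb : ∀ {X} {I : Set ℓ} (P : I → Fib X) (Q : Fib X) →
            (∀ i → Q ⊑ P i) → Q ⊑ ⋀ P
    _^*_ : ∀ {X Y} → Hom X Y → Fib Y → Fib X
    ^*-mono : ∀ {X Y} (f : Hom X Y) {P Q : Fib Y} → P ⊑ Q → f ^* P ⊑ f ^* Q
    ^*-⋀ : ∀ {X Y} (f : Hom X Y) {I : Set ℓ} (P : I → Fib Y) →
           f ^* ⋀ P ≡ ⋀ (λ i → f ^* P i)
    ^*-id : ∀ {X} (P : Fib X) → id ^* P ≡ P
    ^*-∘ : ∀ {X Y Z} (g : Hom Y Z) (f : Hom X Y) (P : Fib Z) →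
           (g ∘ f) ^* P ≡ f ^* (g ^* P)

  EHom : ∀ {X Y} → Fib X → Fib Y → Set ℓ
  EHom {X} {Y} P Q = Σ (Hom X Y) λ f → P ⊑ f ^* Q

  p₁ : ∀ {X Y} {P : Fib X} {Q : Fib Y} → EHom P Q → Hom X Y
  p₁ = proj₁

record Game (ℓ : Level) : Set (lsuc ℓ) where
  field
    SpoilerPos    : Set ℓ
    DuplicatorPos : Set ℓ
    spoilerMove    : SpoilerPos → DuplicatorPos → Set ℓ
    duplicatorMove : DuplicatorPos → SpoilerPos → Set ℓ

IsDuplicatorInvariant : ∀ {ℓ} (G : Game ℓ) → (Game.SpoilerPos G → Set ℓ) → Set ℓ
IsDuplicatorInvariant G V =
  ∀ q → V q → ∀ q' → spoilerMove q q' →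
  Σ SpoilerPos λ q'' → V q'' × duplicatorMove q' q''
  where open Game G

module CodensityGames
  {ℓ : Level} (B : Category ℓ) (𝔽 : CLatFibration B)
  (A : Set ℓ)                                    -- discrete index of truth values
  (O : A → Category.Ob B)
  (Ω : (a : A) → CLatFibration.Fib 𝔽 (O a))      -- so O = p ∘ Ω
  (F : Endofunctor B)
  (τ : (a : A) → Category.Hom B (Endofunctor.F₀ F (O a)) (O a))
  (N : ℕ) (T : NaryFunctor N B)
  (σ : (a : A) → Category.Hom B (NaryFunctor.T₀ T (λ _ → O a)) (O a))
  where
  open Category B
  open CLatFibration 𝔽
  open Endofunctor F
  open NaryFunctor T

  codensityGame : (X : Ob) → Hom X (F₀ X) → Game ℓ
  codensityGame X c = record
    { SpoilerPos = Fib X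
    ; DuplicatorPos = Σ A (λ a → Hom X (O a))
    ; spoilerMove = λ P ak → ¬ (P ⊑ (τ (proj₁ ak) ∘ F₁ (proj₂ ak) ∘ c) ^* Ω (proj₁ ak))
    ; duplicatorMove = λ ak P′ → ¬ (P′ ⊑ proj₂ ak ^* Ω (proj₁ ak))
    }

  TΩσ : (X : Fin N → Ob) → ((i : Fin N) → Fib (X i)) → Fib (T₀ X)
  TΩσ X P =
    ⋀ {I = Σ A (λ a → (i : Fin N) → EHom (P i) (Ω a))}
      (λ ak → (σ (proj₁ ak) ∘ T₁ (λ i → p₁ (proj₂ ak i))) ^* Ω (proj₁ ak))

  compositeGame : (X : Fin N → Ob) → ((i : Fin N) → Hom (X i) (F₀ (X i))) → Game ℓ
  compositeGame X c = record
    { SpoilerPos = (i : Fin N) → Fib (X i)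
    ; DuplicatorPos = Σ A (λ a → (i : Fin N) → Hom (X i) (O a))
    ; spoilerMove = λ P ak →
        ¬ (TΩσ X P ⊑
           (σ (proj₁ ak) ∘ T₁ (λ i → τ (proj₁ ak) ∘ F₁ (proj₂ ak i) ∘ c i)) ^* Ω (proj₁ ak))
    ; duplicatorMove = λ ak P′ →
        Σ (Fin N) (λ i → ¬ (P′ i ⊑ proj₂ ak i ^* Ω (proj₁ ak)))
    }

module Submission where

open import Defs
open import Level using (Level)
open import Data.Nat using (ℕ)
open import Data.Fin using (Fin; _≟_)
open import Data.Fin.Properties using (¬∀⟶∃¬)
open import Data.Product using (Σ; _,_; proj₁)
open import Relation.Nullary using (¬_; yes; no)
open import Relation.Binary.PropositionalEquality using (_≡_; refl; sym; subst)
open import Data.Empty using (⊥-elim)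
open import Axiom.ExcludedMiddle using (ExcludedMiddle)

-- A Spoiler move (a , k) of the composite game from P can only be legal because some
-- component P i already admits the Spoiler move (a , k i) in 𝒢_{c i}: otherwise the maps
-- τ a ∘ F k i ∘ c i index one of the meetands of T^Ω_σ P.  Duplicator answers with the
-- local invariant at that component and leaves the others unchanged.

module _ {n a} {A : Fin n → Set a} where

  updateAt : (i : Fin n) → A i → ((j : Fin n) → A j) → (j : Fin n) → A j
  updateAt i x f j with j ≟ i
  ... | yes refl = x
  ... | no _     = f j

  updateAt-updates : ∀ i x f → updateAt i x f i ≡ x
  updateAt-updates i x f with i ≟ i
  ... | yes refl = refl
  ... | no i≢i   = ⊥-elim (i≢i refl)

  updateAt-preserves : ∀ {r} (R : (j : Fin n) → A j → Set r) {i x f} →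
                       R i x → (∀ j → R j (f j)) → ∀ j → R j (updateAt i x f j)
  updateAt-preserves R {i} Rx Rf j with j ≟ i
  ... | yes refl = Rx
  ... | no _     = Rf j

module CompositeInvariant
  {ℓ : Level} (B : Category ℓ) (𝔽 : CLatFibration B)
  (A : Set ℓ)
  (O : A → Category.Ob B)
  (Ω : (a : A) → CLatFibration.Fib 𝔽 (O a))
  (F : Endofunctor B)
  (τ : (a : A) → Category.Hom B (Endofunctor.F₀ F (O a)) (O a))
  (N : ℕ) (T : NaryFunctor N B)
  (σ : (a : A) → Category.Hom B (NaryFunctor.T₀ T (λ _ → O a)) (O a))
  where
  open Category B
  open CLatFibration 𝔽
  open Endofunctor F
  open NaryFunctor T
  open CodensityGames B 𝔽 A O Ω F τ N T σ
  open Game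

  TΩσ-⊑ : ∀ {X} (P : (i : Fin N) → Fib (X i)) (a : A) (f : (i : Fin N) → Hom (X i) (O a)) →
          (∀ i → P i ⊑ f i ^* Ω a) → TΩσ X P ⊑ (σ a ∘ T₁ f) ^* Ω a
  TΩσ-⊑ P a f P⊑f = ⋀-lb _ (a , λ i → f i , P⊑f i)

  compositeSpoilerMove⇒spoilerMove :
    ExcludedMiddle ℓ → ∀ {X c} {P : (i : Fin N) → Fib (X i)} {a k} →
    spoilerMove (compositeGame X c) P (a , k) →
    Σ (Fin N) λ i → spoilerMove (codensityGame (X i) (c i)) (P i) (a , k i)
  compositeSpoilerMove⇒spoilerMove lem {X} {c} {P} {a} {k} move =
    ¬∀⟶∃¬ N _ (λ _ → lem) λ P⊑ → move (TΩσ-⊑ P a (λ i → τ a ∘ F₁ (k i) ∘ c i) P⊑)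

  productInvariant :
    ExcludedMiddle ℓ → ∀ X c (V : (i : Fin N) → Fib (X i) → Set ℓ) →
    (∀ i → IsDuplicatorInvariant (codensityGame (X i) (c i)) (V i)) →
    IsDuplicatorInvariant (compositeGame X c) (λ P → ∀ i → V i (P i))
  productInvariant lem X c V inv P VP (a , k) move
    with compositeSpoilerMove⇒spoilerMove lem move
  ... | i , localMove with inv i (P i) (VP i) (a , k i) localMove
  ...   | P″ , VP″ , P″⋢ =
    updateAt i P″ P ,
    updateAt-preserves V VP″ VP ,
    (i , subst (λ Q → ¬ (Q ⊑ k i ^* Ω a)) (sym (updateAt-updates i P″ P)) P″⋢)

proposition15 : {ℓ : Level} → ExcludedMiddle ℓ →
    (B : Category ℓ) (𝔽 : CLatFibration B) (A : Set ℓ)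
    (O : A → Category.Ob B) (Ω : (a : A) → CLatFibration.Fib 𝔽 (O a))
    (F : Endofunctor B)
    (τ : (a : A) → Category.Hom B (Endofunctor.F₀ F (O a)) (O a))
    (N : ℕ) (T : NaryFunctor N B)
    (σ : (a : A) → Category.Hom B (NaryFunctor.T₀ T (λ _ → O a)) (O a))
    (X : Fin N → Category.Ob B)
    (c : (i : Fin N) → Category.Hom B (X i) (Endofunctor.F₀ F (X i)))
    (V : (i : Fin N) → CLatFibration.Fib 𝔽 (X i) → Set ℓ) →
    ((i : Fin N) →
      IsDuplicatorInvariant (CodensityGames.codensityGame B 𝔽 A O Ω F τ N T σ (X i) (c i)) (V i)) →
    IsDuplicatorInvariant (CodensityGames.compositeGame B 𝔽 A O Ω F τ N T σ X c)
      (λ P → (i : Fin N) → V i (P i))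
proposition15 lem B 𝔽 A O Ω F τ N T σ =
  CompositeInvariant.productInvariant B 𝔽 A O Ω F τ N T σ lem
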